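{- Let $I(t,x,y)=\sum_G t^{\mathrm{iuc}(G)}x^{\#H(G)}y^{\#U(G)}$, the sum over all bargraphs $G$. Then $$I=\frac{1-2x-y+x^2+(2t-1)x^2y-(1-x)\sqrt{(1-y)\bigl((1-x)^2-y(1+x)^2\bigr)}}{2x(1-tx)}.$$
   Context: A bargraph is a lattice path with steps $U=(0,1)$, $H=(1,0)$, $D=(0,-1)$, identified with its word over $\{U,H,D\}$, that starts at the origin, ends on the $x$-axis, stays strictly above the $x$-axis except at its endpoints, and contains no two consecutive steps $UD$ or $DU$ (the empty path is not a bargraph). $\#H(G)$, $\#U(G)$ denote the numbers of $H$ and $U$ steps. $\mathrm{iuc}(G)$, the number of initial columns of height $1$, is the largest $j\ge0$ such that $G$ begins with $UH^j$. -}

module Defs where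

open import Data.Nat using (ℕ; zero; suc; _+_; _*_; _≡ᵇ_)
open import Data.Bool using (Bool; true; false; _∧_; if_then_else_)
open import Data.List using (List; []; _∷_; length; filter; map; concatMap)
open import Data.Integer as ℤ using (ℤ; +_; 0ℤ; 1ℤ)
open import Relation.Binary.PropositionalEquality using (_≡_)
open import Relation.Nullary.Decidable using (Dec; yes; no)
open import Data.Bool.Properties using () renaming (_≟_ to _≟ᵇ_)

data Step : Set where
  U H D : Step

Word : Set
Word = List Step

words : ℕ → List Word
words zero    = [] ∷ []
words (suc n) = concatMap (λ w → (U ∷ w) ∷ (H ∷ w) ∷ (D ∷ w) ∷ []) (words n)

#H : Word → ℕ
#H []       = 0
#H (H ∷ w)  = suc (#H w)
#H (_ ∷ w)  = #H w

#U : Word → ℕ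
#U []       = 0
#U (U ∷ w)  = suc (#U w)
#U (_ ∷ w)  = #U w

noUDDU : Word → Bool
noUDDU (U ∷ D ∷ _)  = false
noUDDU (D ∷ U ∷ _)  = false
noUDDU (_ ∷ w)      = noUDDU w
noUDDU []           = true

-- walk h w : starting at height h (h ≥ 1, strictly above the axis),
-- following w stays strictly above the x-axis and reaches height 0
-- exactly at the very last step.
walk : ℕ → Word → Bool
walk zero          _            = false
walk (suc h)       []           = false
walk (suc h)       (U ∷ w)      = walk (suc (suc h)) w
walk (suc h)       (H ∷ w)      = walk (suc h) w
walk (suc zero)    (D ∷ [])     = true
walk (suc zero)    (D ∷ _ ∷ _)  = false
walk (suc (suc h)) (D ∷ w)      = walk (suc h) w

-- Bargraph: nonempty path from the origin, ending on the x-axis, strictly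
-- above the x-axis except at its endpoints (so the first step is U),
-- with no two consecutive steps UD or DU.
isBargraph : Word → Bool
isBargraph (U ∷ w) = walk 1 (w) ∧ noUDDU (U ∷ w)
isBargraph _       = false

leadingH : Word → ℕ
leadingH (H ∷ w) = suc (leadingH w)
leadingH _       = 0

iuc : Word → ℕ
iuc (U ∷ w) = leadingH w
iuc _       = 0

-- Formal power series in t, x, y with integer coefficients:
-- f a n m is the coefficient of t^a x^n y^m.

PS : Set
PS = ℕ → ℕ → ℕ → ℤ

infix 4 _≈_
_≈_ : PS → PS → Set
f ≈ g = ∀ a n m → f a n m ≡ g a n m

Σ≤ : ℕ → (ℕ → ℤ) → ℤ
Σ≤ zero    f = f 0
Σ≤ (suc n) f = Σ≤ n f ℤ.+ f (suc n)

infixl 6 _⊕_ _⊖_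
infixl 7 _⊛_

_⊕_ : PS → PS → PS
(f ⊕ g) a n m = f a n m ℤ.+ g a n m

_⊖_ : PS → PS → PS
(f ⊖ g) a n m = f a n m ℤ.- g a n m

_⊛_ : PS → PS → PS
(f ⊛ g) a n m =
  Σ≤ a λ i → Σ≤ n λ j → Σ≤ m λ k →
    f i j k ℤ.* g (a ℤ∸ i) (n ℤ∸ j) (m ℤ∸ k)
  where
  open import Data.Nat using () renaming (_∸_ to _ℤ∸_)

const : ℤ → PS
const c zero zero zero = c
const c _    _    _    = 0ℤ

𝟙 𝟚 : PS
𝟙 = const 1ℤ
𝟚 = const (+ 2)

T X Y : PS
T (suc zero) zero zero = 1ℤ
T _ _ _ = 0ℤ
X zero (suc zero) zero = 1ℤ
X _ _ _ = 0ℤ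
Y zero zero (suc zero) = 1ℤ
Y _ _ _ = 0ℤ

-- A bargraph with #H = n and #U = m has #D = #U = m (it ends at height 0),
-- hence length n + 2m; so all such bargraphs are among words (n + 2 * m).


I : PS
I a n m = + length (filter (λ w → (isBargraph w ∧ (iuc w ≡ᵇ a) ∧ (#H w ≡ᵇ n) ∧ (#U w ≡ᵇ m)) ≟ᵇ true)
                           (words (n + 2 * m)))

Pnum : PS
Pnum = 𝟙 ⊖ 𝟚 ⊛ X ⊖ Y ⊕ X ⊛ X ⊕ (𝟚 ⊛ T ⊖ 𝟙) ⊛ X ⊛ X ⊛ Y

Rad : PS
Rad = (𝟙 ⊖ Y) ⊛ ((𝟙 ⊖ X) ⊛ (𝟙 ⊖ X) ⊖ Y ⊛ ((𝟙 ⊕ X) ⊛ (𝟙 ⊕ X)))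

Den : PS
Den = 𝟚 ⊛ X ⊛ (𝟙 ⊖ T ⊛ X)

module Submission where

-- A bargraph is a U step followed by a descent from height 1, i.e. a path that stays above
-- the axis and first reaches it with its last step.  Let Desc h l count the descents from
-- height h + 1 that may follow a step l (the ban on UD and DU makes l matter).  Splitting
-- off the first step gives a linear system relating Desc h and Desc (h + 1); the products
-- Desc h l ⊛ Desc 0 D satisfy the same system, which determines its solution degree by
-- degree, so Desc (h + 1) l ≈ Desc h l ⊛ Desc 0 D.  For P = Desc 0 H this closes the system
-- into x y P² − (1 − x)(1 − y) P + (1 − y) = 0, so S = (1 − x)(1 − y) − 2 x y P squares to
-- the radicand.  The variable t only sees the run of H steps after the initial U: bargraphs
-- with their first step removed (Descᵗ U) satisfy (1 − t x) Descᵗ U = y Desc 1 U + t x,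
-- and I = y Descᵗ U.

open import Algebra.Bundles using (CommutativeRing; RawRing)
open import Algebra.Structures using (IsCommutativeRing; IsAbelianGroup)
open import Algebra.Morphism.Structures using (IsRingMonomorphism)
import Algebra.Morphism.RingMonomorphism as RingMonomorphism
import Algebra.Construct.Pointwise as Pointwise
import Algebra.Consequences.Setoid as Consequences
import Algebra.Properties.Group as GroupProperties
import Algebra.Properties.CommutativeSemigroup as CommutativeSemigroupProperties
open import Data.Nat using (ℕ; zero; suc; _∸_; _≤_; z≤n)
open import Data.Nat.Properties using (m∸[m∸n]≡n; ≤-refl; m≤n⇒m≤1+n)
open import Function using (id)
import Relation.Binary.PropositionalEquality as ≡

module PowerSeries {c ℓ} (R : CommutativeRing c ℓ) where

  open CommutativeRing R hiding (isCommutativeRing)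
  open import Relation.Binary.Reasoning.Setoid setoid
  open CommutativeSemigroupProperties +-commutativeSemigroup using (interchange)

  Series : Set c
  Series = ℕ → Carrier

  infix  4 _≋_
  infixl 6 _⊞_
  infixl 7 _⊠_

  _≋_ : Series → Series → Set ℓ
  f ≋ g = ∀ n → f n ≈ g n

  _⊞_ : Series → Series → Series
  (f ⊞ g) n = f n + g n

  ⊟_ : Series → Series
  (⊟ f) n = - f n

  0ₛ 1ₛ : Series
  0ₛ _       = 0#
  1ₛ zero    = 1#
  1ₛ (suc _) = 0#

  sum≤ : ℕ → (ℕ → Carrier) → Carrier
  sum≤ zero    f = f 0
  sum≤ (suc n) f = sum≤ n f + f (suc n)

  _⊠_ : Series → Series → Series
  (f ⊠ g) n = sum≤ n λ i → f i * g (n ∸ i)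

  sum≤-cong : ∀ n {f g} → (∀ i → i ≤ n → f i ≈ g i) → sum≤ n f ≈ sum≤ n g
  sum≤-cong zero    f≈g = f≈g 0 z≤n
  sum≤-cong (suc n) f≈g =
    +-cong (sum≤-cong n λ i i≤n → f≈g i (m≤n⇒m≤1+n i≤n)) (f≈g (suc n) ≤-refl)

  sum≤-distrib-+ : ∀ n f g → sum≤ n (λ i → f i + g i) ≈ sum≤ n f + sum≤ n g
  sum≤-distrib-+ zero    f g = refl
  sum≤-distrib-+ (suc n) f g =
    trans (+-congʳ (sum≤-distrib-+ n f g)) (interchange _ _ _ _)

  *-distribˡ-sum≤ : ∀ n a f → a * sum≤ n f ≈ sum≤ n (λ i → a * f i)
  *-distribˡ-sum≤ zero    a f = refl
  *-distribˡ-sum≤ (suc n) a f = trans (distribˡ a _ _) (+-congʳ (*-distribˡ-sum≤ n a f))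

  sum≤-zero : ∀ n f → (∀ i → f i ≈ 0#) → sum≤ n f ≈ 0#
  sum≤-zero zero    f f≈0 = f≈0 0
  sum≤-zero (suc n) f f≈0 = trans (+-cong (sum≤-zero n f f≈0) (f≈0 (suc n))) (+-identityˡ 0#)

  sum≤-unconsˡ : ∀ n f → sum≤ (suc n) f ≈ f 0 + sum≤ n (λ i → f (suc i))
  sum≤-unconsˡ zero    f = refl
  sum≤-unconsˡ (suc n) f = trans (+-congʳ (sum≤-unconsˡ n f)) (+-assoc _ _ _)

  sum≤-reverse : ∀ n f → sum≤ n f ≈ sum≤ n (λ i → f (n ∸ i))
  sum≤-reverse zero    f = refl
  sum≤-reverse (suc n) f = begin
    sum≤ n f + f (suc n)                     ≈⟨ +-congʳ (sum≤-reverse n f) ⟩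
    sum≤ n (λ i → f (n ∸ i)) + f (suc n)     ≈⟨ +-comm _ _ ⟩
    f (suc n) + sum≤ n (λ i → f (n ∸ i))     ≈⟨ sum≤-unconsˡ n (λ i → f (suc n ∸ i)) ⟨
    sum≤ (suc n) (λ i → f (suc n ∸ i))       ∎

  ⊠-cong : ∀ {f f′ g g′} → f ≋ f′ → g ≋ g′ → f ⊠ g ≋ f′ ⊠ g′
  ⊠-cong f≋f′ g≋g′ n = sum≤-cong n λ i _ → *-cong (f≋f′ i) (g≋g′ (n ∸ i))

  ⊠-comm : ∀ f g → f ⊠ g ≋ g ⊠ f
  ⊠-comm f g n = trans (sum≤-reverse n _) (sum≤-cong n λ i i≤n →
    trans (*-comm _ _) (*-congʳ (reflexive (≡.cong g (m∸[m∸n]≡n i≤n)))))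

  ⊠-distribʳ : ∀ h f g → (f ⊞ g) ⊠ h ≋ f ⊠ h ⊞ g ⊠ h
  ⊠-distribʳ h f g n =
    trans (sum≤-cong n λ i _ → distribʳ (h (n ∸ i)) (f i) (g i)) (sum≤-distrib-+ n _ _)

  ⊠-identityˡ : ∀ f → 1ₛ ⊠ f ≋ f
  ⊠-identityˡ f zero    = *-identityˡ (f 0)
  ⊠-identityˡ f (suc n) = begin
    (1ₛ ⊠ f) (suc n)
      ≈⟨ sum≤-unconsˡ n _ ⟩
    1# * f (suc n) + sum≤ n (λ i → 0# * f (n ∸ i))
      ≈⟨ +-cong (*-identityˡ _) (sum≤-zero n _ λ _ → zeroˡ _) ⟩
    f (suc n) + 0#
      ≈⟨ +-identityʳ _ ⟩
    f (suc n) ∎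

  tail : Series → Series
  tail f n = f (suc n)

  ⊠-suc : ∀ f g n → (f ⊠ g) (suc n) ≈ f 0 * g (suc n) + (tail f ⊠ g) n
  ⊠-suc f g n = sum≤-unconsˡ n _

  ⊠-assoc : ∀ f g h → (f ⊠ g) ⊠ h ≋ f ⊠ (g ⊠ h)
  ⊠-assoc f g h zero    = *-assoc (f 0) (g 0) (h 0)
  ⊠-assoc f g h (suc n) = begin
    ((f ⊠ g) ⊠ h) (suc n)
      ≈⟨ ⊠-suc (f ⊠ g) h n ⟩
    f 0 * g 0 * h (suc n) + (tail (f ⊠ g) ⊠ h) n
      ≈⟨ +-congˡ (⊠-cong {g = h} (λ k → ⊠-suc f g k) (λ _ → refl) n) ⟩
    f 0 * g 0 * h (suc n) + ((f 0 *ₗ tail g ⊞ tail f ⊠ g) ⊠ h) n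
      ≈⟨ +-congˡ (⊠-distribʳ h (f 0 *ₗ tail g) (tail f ⊠ g) n) ⟩
    f 0 * g 0 * h (suc n) + (((f 0 *ₗ tail g) ⊠ h) n + ((tail f ⊠ g) ⊠ h) n)
      ≈⟨ +-congˡ (+-cong (scale (tail g) n) (⊠-assoc (tail f) g h n)) ⟩
    f 0 * g 0 * h (suc n) + (f 0 * (tail g ⊠ h) n + (tail f ⊠ (g ⊠ h)) n)
      ≈⟨ +-assoc _ _ _ ⟨
    f 0 * g 0 * h (suc n) + f 0 * (tail g ⊠ h) n + (tail f ⊠ (g ⊠ h)) n
      ≈⟨ +-congʳ (trans (+-congʳ (*-assoc _ _ _)) (sym (distribˡ _ _ _))) ⟩
    f 0 * (g 0 * h (suc n) + (tail g ⊠ h) n) + (tail f ⊠ (g ⊠ h)) n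
      ≈⟨ +-congʳ (*-congˡ (⊠-suc g h n)) ⟨
    f 0 * (g ⊠ h) (suc n) + (tail f ⊠ (g ⊠ h)) n
      ≈⟨ ⊠-suc f (g ⊠ h) n ⟨
    (f ⊠ (g ⊠ h)) (suc n) ∎
    where
    _*ₗ_ : Carrier → Series → Series
    (a *ₗ u) k = a * u k
    scale : ∀ u k → ((f 0 *ₗ u) ⊠ h) k ≈ f 0 * (u ⊠ h) k
    scale u k = trans (sum≤-cong k λ i _ → *-assoc _ _ _) (sym (*-distribˡ-sum≤ k _ _))

  isCommutativeRing : IsCommutativeRing _≋_ _⊞_ _⊠_ ⊟_ 0ₛ 1ₛ
  isCommutativeRing = record
    { isRing = record
      { +-isAbelianGroup = ⊞-isAbelianGroup
      ; *-cong           = ⊠-cong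
      ; *-assoc          = ⊠-assoc
      ; *-identity       = comm∧idˡ⇒id ⊠-comm ⊠-identityˡ
      ; distrib          = comm∧distrʳ⇒distr ⊞-cong ⊠-comm ⊠-distribʳ
      }
    ; *-comm = ⊠-comm
    }
    where
    ⊞-isAbelianGroup : IsAbelianGroup _≋_ _⊞_ 0ₛ ⊟_
    ⊞-isAbelianGroup = Pointwise.isAbelianGroup ℕ +-isAbelianGroup
    open IsAbelianGroup ⊞-isAbelianGroup using () renaming (setoid to ≋-setoid; ∙-cong to ⊞-cong)
    open Consequences ≋-setoid

  commutativeRing : CommutativeRing c ℓ
  commutativeRing = record { isCommutativeRing = isCommutativeRing }

module _ {c ℓ} (R : CommutativeRing c ℓ) where

  open CommutativeRing R

  isCommutativeRing-cong-*-1# : ∀ {_*′_ 1#′} → (∀ x y → (x *′ y) ≈ (x * y)) → 1#′ ≈ 1# →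
                                IsCommutativeRing _≈_ _+_ _*′_ -_ 0# 1#′
  isCommutativeRing-cong-*-1# {_*′_} {1#′} *′≈* 1#′≈1# =
    RingMonomorphism.isCommutativeRing identity isCommutativeRing
    where
    rawRing′ : RawRing c ℓ
    rawRing′ = record
      { Carrier = Carrier ; _≈_ = _≈_ ; _+_ = _+_ ; _*_ = _*′_ ; -_ = -_ ; 0# = 0# ; 1# = 1#′ }
    identity : IsRingMonomorphism rawRing′ rawRing id
    identity = record
      { isRingHomomorphism = record
        { isSemiringHomomorphism = record
          { isNearSemiringHomomorphism = record
            { +-isMonoidHomomorphism = record
              { isMagmaHomomorphism = record
                { isRelHomomorphism = record { cong = id }
                ; homo = λ _ _ → refl }
              ; ε-homo = refl }
            ; *-homo = *′≈* }
          ; 1#-homo = 1#′≈1# }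
        ; -‿homo = λ _ → refl }
      ; injective = id }

  ≈-modulo : ∀ {a b x y} c → a ≈ b → x ≈ y + c * (a - b) → x ≈ y
  ≈-modulo {y = y} c a≈b x≈y+c[a-b] =
    trans x≈y+c[a-b] (trans (+-congˡ (trans (*-congˡ (x≈y⇒x∙y⁻¹≈ε a≈b)) (zeroʳ c)))
                            (+-identityʳ y))
    where open GroupProperties +-group using (x≈y⇒x∙y⁻¹≈ε)

open import Defs
open import Algebra.Solver.Ring.AlmostCommutativeRing using (fromCommutativeRing; _-Raw-AlmostCommutative⟶_)
open import Data.Bool using (Bool; true; false; _∧_)
open import Data.Bool.Properties using (∧-zeroʳ) renaming (_≟_ to _≟ᵇ_)
open import Data.Empty using (⊥-elim)
open import Data.Integer as ℤ using (ℤ; +_; 0ℤ; 1ℤ; -1ℤ)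
import Data.Integer.Properties as ℤ
open import Data.List using (List; []; _∷_; length; filter; concatMap)
open import Data.Maybe using (Maybe; just; nothing)
open import Data.Nat using (_+_; _*_; _≡ᵇ_; _<_; s≤s⁻¹)
open import Data.Nat.Properties using (+-suc; +-identityʳ; +-mono-≤; ≤-<-trans; m∸n≤m)
open import Data.Nat.Tactic.RingSolver using (solve-∀)
open import Data.Product using (Σ; _×_; _,_)
open import Relation.Binary.Bundles using (Setoid)
open import Relation.Nullary using (yes; no)
open ≡ using (_≡_; _≢_; refl; sym; trans; cong; cong₂; subst; module ≡-Reasoning)

module ℤ[[y]]     = PowerSeries ℤ.+-*-commutativeRing
module ℤ[[x,y]]   = PowerSeries ℤ[[y]].commutativeRing
module ℤ[[t,x,y]] = PowerSeries ℤ[[x,y]].commutativeRing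

Σ≤≗sum≤ : ∀ n f → Σ≤ n f ≡ ℤ[[y]].sum≤ n f
Σ≤≗sum≤ zero    f = refl
Σ≤≗sum≤ (suc n) f = cong (ℤ._+ f (suc n)) (Σ≤≗sum≤ n f)

sum≤-apply₂ : ∀ n G m → ℤ[[x,y]].sum≤ n G m ≡ Σ≤ n (λ j → G j m)
sum≤-apply₂ zero    G m = refl
sum≤-apply₂ (suc n) G m = cong (ℤ._+ G (suc n) m) (sum≤-apply₂ n G m)

sum≤-apply₃ : ∀ a F n m → ℤ[[t,x,y]].sum≤ a F n m ≡ Σ≤ a (λ i → F i n m)
sum≤-apply₃ zero    F n m = refl
sum≤-apply₃ (suc a) F n m = cong (ℤ._+ F (suc a) n m) (sum≤-apply₃ a F n m)

Σ≤-cong : ∀ n {f g : ℕ → ℤ} → (∀ i → i ≤ n → f i ≡ g i) → Σ≤ n f ≡ Σ≤ n g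
Σ≤-cong zero    f≗g = f≗g 0 z≤n
Σ≤-cong (suc n) f≗g =
  cong₂ ℤ._+_ (Σ≤-cong n λ i i≤n → f≗g i (m≤n⇒m≤1+n i≤n)) (f≗g (suc n) ≤-refl)

⊛≈⊠ : ∀ f g → f ⊛ g ≈ f ℤ[[t,x,y]].⊠ g
⊛≈⊠ f g a n m = sym (trans (sum≤-apply₃ a _ n m) (Σ≤-cong a λ i _ →
  trans (sum≤-apply₂ n _ m) (Σ≤-cong n λ j _ → sym (Σ≤≗sum≤ m _))))

𝟙≈1ₛ : 𝟙 ≈ ℤ[[t,x,y]].1ₛ
𝟙≈1ₛ zero    zero    zero    = refl
𝟙≈1ₛ zero    zero    (suc m) = refl
𝟙≈1ₛ zero    (suc n) m       = refl
𝟙≈1ₛ (suc a) n       m       = refl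

PS-commutativeRing : CommutativeRing _ _
PS-commutativeRing = record
  { Carrier = PS ; _≈_ = _≈_ ; _+_ = _⊕_ ; _*_ = _⊛_
  ; -_ = ℤ[[t,x,y]].⊟_ ; 0# = ℤ[[t,x,y]].0ₛ ; 1# = 𝟙
  ; isCommutativeRing = isCommutativeRing-cong-*-1# ℤ[[t,x,y]].commutativeRing ⊛≈⊠ 𝟙≈1ₛ
  }

Σ≤-zero : ∀ n {f : ℕ → ℤ} → (∀ i → f i ≡ 0ℤ) → Σ≤ n f ≡ 0ℤ
Σ≤-zero zero    f≗0 = f≗0 0
Σ≤-zero (suc n) f≗0 = cong₂ ℤ._+_ (Σ≤-zero n f≗0) (f≗0 (suc n))

Σ≤-head : ∀ n {f : ℕ → ℤ} → (∀ i → f (suc i) ≡ 0ℤ) → Σ≤ n f ≡ f 0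
Σ≤-head zero    _     = refl
Σ≤-head (suc n) {f} f∘suc≗0 =
  trans (cong₂ ℤ._+_ (Σ≤-head n f∘suc≗0) (f∘suc≗0 n)) (ℤ.+-identityʳ (f 0))

Σ≤-second : ∀ n {f : ℕ → ℤ} → f 0 ≡ 0ℤ → (∀ i → f (suc (suc i)) ≡ 0ℤ) → Σ≤ (suc n) f ≡ f 1
Σ≤-second zero    {f} f0≡0 _    = trans (cong (ℤ._+ f 1) f0≡0) (ℤ.+-identityˡ (f 1))
Σ≤-second (suc n) {f} f0≡0 f2+≡0 =
  trans (cong₂ ℤ._+_ (Σ≤-second n f0≡0 f2+≡0) (f2+≡0 n)) (ℤ.+-identityʳ (f 1))

const-⊛ : ∀ c f a n m → (const c ⊛ f) a n m ≡ c ℤ.* f a n m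
const-⊛ c f a n m =
  trans (Σ≤-head a λ _ → Σ≤-zero n λ _ → Σ≤-zero m λ _ → refl)
  (trans (Σ≤-head n λ _ → Σ≤-zero m λ _ → refl)
           (Σ≤-head m λ _ → refl))

const-map₂ : ∀ (φ : ℤ → ℤ → ℤ) → φ 0ℤ 0ℤ ≡ 0ℤ →
             ∀ c d → const (φ c d) ≈ λ a n m → φ (const c a n m) (const d a n m)
const-map₂ φ φ00≡0 c d zero    zero    zero    = refl
const-map₂ φ φ00≡0 c d zero    zero    (suc m) = sym φ00≡0
const-map₂ φ φ00≡0 c d zero    (suc n) m       = sym φ00≡0
const-map₂ φ φ00≡0 c d (suc a) n       m       = sym φ00≡0

module PS-Solver where

  const-homo : CommutativeRing.rawRing ℤ.+-*-commutativeRing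
               -Raw-AlmostCommutative⟶ fromCommutativeRing PS-commutativeRing
  const-homo = record
    { ⟦_⟧    = const
    ; +-homo = const-map₂ ℤ._+_ refl
    ; *-homo = λ c d a n m →
        trans (const-map₂ (λ _ e → c ℤ.* e) (ℤ.*-zeroʳ c) c d a n m) (sym (const-⊛ c (const d) a n m))
    ; -‿homo = λ c → const-map₂ (λ e _ → ℤ.- e) refl c c
    ; 0-homo = const-map₂ (λ _ _ → 0ℤ) refl 0ℤ 0ℤ
    ; 1-homo = λ _ _ _ → refl
    }

  const-≟ : ∀ c d → Maybe (const c ≈ const d)
  const-≟ c d with c ℤ.≟ d
  ... | yes c≡d = just λ a n m → cong (λ e → const e a n m) c≡d
  ... | no  _   = nothing

  open import Algebra.Solver.Ring (CommutativeRing.rawRing ℤ.+-*-commutativeRing)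
    (fromCommutativeRing PS-commutativeRing) const-homo const-≟ public

open CommutativeRing PS-commutativeRing
  using (+-cong; +-congˡ; +-congʳ; *-cong; *-congˡ; *-congʳ; *-assoc; *-identityˡ; distribʳ)
  renaming (setoid to ≈-setoid; sym to ≈-sym; trans to ≈-trans)
open PS-Solver using (solve; _:+_; _:-_; _:*_; _:=_; con)

length-after-U : ∀ n m h → n + 2 * suc m + h ≡ n + 2 * m + suc (suc h)
length-after-U = solve-∀

∧-falseʳ : ∀ a {b} → b ≡ false → a ∧ b ≡ false
∧-falseʳ a refl = ∧-zeroʳ a

indicator : Bool → ℕ
indicator true  = 1
indicator false = 0

countIn : (Word → Bool) → List Word → ℕ
countIn p ws = length (filter (λ w → p w ≟ᵇ true) ws)

count : (Word → Bool) → ℕ → ℕ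
count p L = countIn p (words L)

countIn-∷ : ∀ p w ws → countIn p (w ∷ ws) ≡ indicator (p w) + countIn p ws
countIn-∷ p w ws with p w
... | true  = refl
... | false = refl

count-suc : ∀ p L → count p (suc L) ≡
  count (λ w → p (U ∷ w)) L + count (λ w → p (H ∷ w)) L + count (λ w → p (D ∷ w)) L
count-suc p L = countIn-extend (words L)
  where
  pU pH pD : Word → Bool
  pU w = p (U ∷ w)
  pH w = p (H ∷ w)
  pD w = p (D ∷ w)
  extend : Word → List Word
  extend w = (U ∷ w) ∷ (H ∷ w) ∷ (D ∷ w) ∷ []
  countIn-extend : ∀ ws → countIn p (concatMap extend ws) ≡ countIn pU ws + countIn pH ws + countIn pD ws
  countIn-extend []       = refl
  countIn-extend (w ∷ ws) = begin
    countIn p (concatMap extend (w ∷ ws))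
      ≡⟨ countIn-∷ p _ _ ⟩
    u + countIn p ((H ∷ w) ∷ (D ∷ w) ∷ concatMap extend ws)
      ≡⟨ cong (λ k → u + k) (countIn-∷ p _ _) ⟩
    u + (h + countIn p ((D ∷ w) ∷ concatMap extend ws))
      ≡⟨ cong (λ k → u + (h + k)) (countIn-∷ p _ _) ⟩
    u + (h + (d + countIn p (concatMap extend ws)))
      ≡⟨ cong (λ k → u + (h + (d + k))) (countIn-extend ws) ⟩
    u + (h + (d + (countIn pU ws + countIn pH ws + countIn pD ws)))
      ≡⟨ regroup u h d _ _ _ ⟩
    (u + countIn pU ws) + (h + countIn pH ws) + (d + countIn pD ws)
      ≡⟨ cong₂ _+_ (cong₂ _+_ (countIn-∷ pU w ws) (countIn-∷ pH w ws)) (countIn-∷ pD w ws) ⟨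
    countIn pU (w ∷ ws) + countIn pH (w ∷ ws) + countIn pD (w ∷ ws) ∎
    where
    open ≡-Reasoning
    u = indicator (pU w)
    h = indicator (pH w)
    d = indicator (pD w)
    regroup : ∀ a b c x y z → a + (b + (c + (x + y + z))) ≡ (a + x) + (b + y) + (c + z)
    regroup = solve-∀

count-cong : ∀ {p q L L′} → (∀ w → p w ≡ q w) → L ≡ L′ → count p L ≡ count q L′
count-cong {p} {q} {L} p≗q refl = go (words L)
  where
  go : ∀ ws → countIn p ws ≡ countIn q ws
  go []       = refl
  go (w ∷ ws) = trans (countIn-∷ p w ws) (trans (cong₂ _+_ (cong indicator (p≗q w)) (go ws))
                                                (sym (countIn-∷ q w ws)))

count-none : ∀ {p} L → (∀ w → p w ≡ false) → count p L ≡ 0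
count-none L p≗false = trans (count-cong {L = L} p≗false refl) (go (words L))
  where
  go : ∀ ws → countIn (λ _ → false) ws ≡ 0
  go []       = refl
  go (_ ∷ ws) = go ws

count-none-suc : ∀ {p} L → (∀ s w → p (s ∷ w) ≡ false) → count p (suc L) ≡ 0
count-none-suc {p} L p≗false = begin
  count p (suc L)                                  ≡⟨ count-suc p L ⟩
  count _ L + count _ L + count _ L                ≡⟨ cong₂ _+_ (cong₂ _+_ (count-none L (p≗false U))
                                                       (count-none L (p≗false H))) (count-none L (p≗false D)) ⟩
  0                                                ∎
  where open ≡-Reasoning

ℕ² : Set
ℕ² = ℕ → ℕ → ℕ

-- The coefficient arrays of x F and y F.
↑x ↑y : ℕ² → ℕ²
↑x F zero    m       = 0
↑x F (suc n) m       = F n m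
↑y F n       zero    = 0
↑y F n       (suc m) = F n m

descent : ℕ → Step → ℕ → ℕ → Word → Bool
descent h l n m w = (walk (suc h) w ∧ noUDDU (l ∷ w)) ∧ (#H w ≡ᵇ n) ∧ (#U w ≡ᵇ m)

-- A descent from height h + 1 with n H steps and m U steps has m + h + 1 D steps.
#descents : ℕ → Step → ℕ²
#descents h l n m = count (descent h l n m) (n + 2 * m + suc h)

-- Descents from height h + 1 whose first step is D; for h = 0 only the word D.
#startD : ℕ → ℕ²
#startD zero    zero    zero    = 1
#startD zero    zero    (suc m) = 0
#startD zero    (suc n) m       = 0
#startD (suc h) n       m       = #descents h D n m

count-first-step : ∀ p n m h → count p (n + 2 * m + suc h) ≡
  count (λ w → p (U ∷ w)) (n + 2 * m + h) + count (λ w → p (H ∷ w)) (n + 2 * m + h)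
  + count (λ w → p (D ∷ w)) (n + 2 * m + h)
count-first-step p n m h = trans (count-cong (λ _ → refl) (+-suc (n + 2 * m) h)) (count-suc p (n + 2 * m + h))

after-U : ∀ h l n m → l ≢ D →
          count (λ w → descent h l n m (U ∷ w)) (n + 2 * m + h) ≡ ↑y (#descents (suc h) U) n m
after-U h l n zero    _ = count-none (n + 2 * 0 + h) λ w →
  ∧-falseʳ (walk (2 + h) w ∧ noUDDU (l ∷ U ∷ w)) (∧-zeroʳ (#H w ≡ᵇ n))
after-U h U n (suc m) _   = count-cong (λ _ → refl) (length-after-U n m h)
after-U h H n (suc m) _   = count-cong (λ _ → refl) (length-after-U n m h)
after-U h D n (suc m) D≢D = ⊥-elim (D≢D refl)

after-H : ∀ h l n m → count (λ w → descent h l n m (H ∷ w)) (n + 2 * m + h) ≡ ↑x (#descents h H) n m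
after-H h l zero    m = count-none (2 * m + h) λ w → ∧-zeroʳ (walk (suc h) w ∧ noUDDU (l ∷ H ∷ w))
after-H h U (suc n) m = count-cong (λ _ → refl) (sym (+-suc (n + 2 * m) h))
after-H h H (suc n) m = count-cong (λ _ → refl) (sym (+-suc (n + 2 * m) h))
after-H h D (suc n) m = count-cong (λ _ → refl) (sym (+-suc (n + 2 * m) h))

after-D : ∀ h l n m → l ≢ U → count (λ w → descent h l n m (D ∷ w)) (n + 2 * m + h) ≡ #startD h n m
after-D h       U n       m       U≢U = ⊥-elim (U≢U refl)
after-D (suc h) H n       m       _   = refl
after-D (suc h) D n       m       _   = refl
after-D zero    H zero    zero    _   = refl
after-D zero    D zero    zero    _   = refl
after-D zero    l zero    (suc m) _   = count-none-suc (m + 1 * suc m + 0) λ _ _ → refl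
after-D zero    l (suc n) m       _   = count-none-suc (n + 2 * m + 0) λ _ _ → refl

no-UD : ∀ h n m → count (λ w → descent h D n m (U ∷ w)) (n + 2 * m + h) ≡ 0
no-UD h n m = count-none (n + 2 * m + h) λ w → cong (_∧ _) (∧-zeroʳ (walk (2 + h) w))

no-DU : ∀ h n m → count (λ w → descent h U n m (D ∷ w)) (n + 2 * m + h) ≡ 0
no-DU h n m = count-none (n + 2 * m + h) λ w → cong (_∧ _) (∧-zeroʳ (walk (suc h) (D ∷ w)))

#descents-U : ∀ h n m → #descents h U n m ≡ ↑y (#descents (suc h) U) n m + ↑x (#descents h H) n m
#descents-U h n m = trans (count-first-step (descent h U n m) n m h)
  (trans (cong₂ _+_ (cong₂ _+_ (after-U h U n m λ ()) (after-H h U n m)) (no-DU h n m)) (+-identityʳ _))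

#descents-H : ∀ h n m →
  #descents h H n m ≡ ↑y (#descents (suc h) U) n m + ↑x (#descents h H) n m + #startD h n m
#descents-H h n m = trans (count-first-step (descent h H n m) n m h)
  (cong₂ _+_ (cong₂ _+_ (after-U h H n m λ ()) (after-H h H n m)) (after-D h H n m λ ()))

#descents-D : ∀ h n m → #descents h D n m ≡ ↑x (#descents h H) n m + #startD h n m
#descents-D h n m = trans (count-first-step (descent h D n m) n m h)
  (cong₂ _+_ (cong₂ _+_ (no-UD h n m) (after-H h D n m)) (after-D h D n m λ ()))

-- Grouped like bargraph (U ∷ w), so that removing the first step of a bargraph is definitional.
descentᵗ : Step → ℕ → ℕ → ℕ → Word → Bool
descentᵗ l a n m w = (walk 1 w ∧ noUDDU (l ∷ w)) ∧ (leadingH w ≡ᵇ a) ∧ (#H w ≡ᵇ n) ∧ (#U w ≡ᵇ m)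

#descentsᵗ : Step → ℕ → ℕ²
#descentsᵗ l a n m = count (descentᵗ l a n m) (n + 2 * m + 1)

no-Hᵗ : ∀ l n m → count (λ w → descentᵗ l 0 n m (H ∷ w)) (n + 2 * m + 0) ≡ 0
no-Hᵗ l n m = count-none (n + 2 * m + 0) λ w → ∧-zeroʳ (walk 1 w ∧ noUDDU (l ∷ H ∷ w))

#descentsᵗ-zero-U : ∀ n m → #descentsᵗ U 0 n m ≡ ↑y (#descents 1 U) n m
#descentsᵗ-zero-U n m = trans (count-first-step (descentᵗ U 0 n m) n m 0)
  (trans (cong₂ _+_ (cong₂ _+_ (after-U 0 U n m λ ()) (no-Hᵗ U n m)) (no-DU 0 n m))
         (trans (+-identityʳ _) (+-identityʳ _)))

#descentsᵗ-zero-H : ∀ n m → #descentsᵗ H 0 n m ≡ ↑y (#descents 1 U) n m + #startD 0 n m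
#descentsᵗ-zero-H n m = trans (count-first-step (descentᵗ H 0 n m) n m 0)
  (cong₂ _+_ (trans (cong₂ _+_ (after-U 0 H n m λ ()) (no-Hᵗ H n m)) (+-identityʳ _)) (after-D 0 H n m λ ()))

#descentsᵗ-suc : ∀ l a n m → l ≢ D → #descentsᵗ l (suc a) n m ≡ ↑x (#descentsᵗ H a) n m
#descentsᵗ-suc l a n m l≢D = trans (count-first-step (descentᵗ l (suc a) n m) n m 0)
  (trans (cong₂ _+_ (cong₂ _+_
    (count-none L λ w → ∧-zeroʳ (walk 2 w ∧ noUDDU (l ∷ U ∷ w)))
    (after-Hᵗ l n l≢D))
    (count-none L λ w → ∧-zeroʳ (walk 1 (D ∷ w) ∧ noUDDU (l ∷ D ∷ w))))
    (+-identityʳ _))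
  where
  L = n + 2 * m + 0
  after-Hᵗ : ∀ l n → l ≢ D →
             count (λ w → descentᵗ l (suc a) n m (H ∷ w)) (n + 2 * m + 0) ≡ ↑x (#descentsᵗ H a) n m
  after-Hᵗ l zero    _   = count-none (2 * m + 0) λ w →
    ∧-falseʳ (walk 1 w ∧ noUDDU (l ∷ H ∷ w)) (∧-zeroʳ (leadingH w ≡ᵇ a))
  after-Hᵗ U (suc n) _   = count-cong (λ _ → refl) (sym (+-suc (n + 2 * m) 0))
  after-Hᵗ H (suc n) _   = count-cong (λ _ → refl) (sym (+-suc (n + 2 * m) 0))
  after-Hᵗ D (suc n) D≢D = ⊥-elim (D≢D refl)

bargraph : ℕ → ℕ → ℕ → Word → Bool
bargraph a n m w = isBargraph w ∧ (iuc w ≡ᵇ a) ∧ (#H w ≡ᵇ n) ∧ (#U w ≡ᵇ m)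

#bargraphs : ℕ → ℕ²
#bargraphs a n m = count (bargraph a n m) (n + 2 * m)

#bargraphs-zero : ∀ a n → #bargraphs a n 0 ≡ 0
#bargraphs-zero a n = count-none (n + 2 * 0) no-U
  where
  no-U : ∀ w → bargraph a n 0 w ≡ false
  no-U []      = refl
  no-U (U ∷ w) =
    ∧-falseʳ (walk 1 w ∧ noUDDU (U ∷ w)) (∧-falseʳ (leadingH w ≡ᵇ a) (∧-zeroʳ (#H w ≡ᵇ n)))
  no-U (H ∷ w) = refl
  no-U (D ∷ w) = refl

#bargraphs-suc : ∀ a n m → #bargraphs a n (suc m) ≡ #descentsᵗ U a n m
#bargraphs-suc a n m = begin
  count (bargraph a n (suc m)) (n + 2 * suc m)
    ≡⟨ count-cong (λ _ → refl) (length-suc n m) ⟩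
  count (bargraph a n (suc m)) (suc L)
    ≡⟨ count-suc (bargraph a n (suc m)) L ⟩
  #descentsᵗ U a n m + count (λ _ → false) L + count (λ _ → false) L
    ≡⟨ cong₂ _+_ (cong₂ _+_ refl (count-none L λ _ → refl)) (count-none L λ _ → refl) ⟩
  #descentsᵗ U a n m + 0 + 0
    ≡⟨ trans (+-identityʳ _) (+-identityʳ _) ⟩
  #descentsᵗ U a n m ∎
  where
  open ≡-Reasoning
  L = n + 2 * m + 1
  length-suc : ∀ n m → n + 2 * suc m ≡ suc (n + 2 * m + 1)
  length-suc = solve-∀

Y⊛-zero : ∀ f a n → (Y ⊛ f) a n 0 ≡ 0ℤ
Y⊛-zero f a n = trans (Σ≤-head a λ _ → Σ≤-zero n λ _ → refl) (Σ≤-head n λ _ → refl)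

Y⊛-suc : ∀ f a n m → (Y ⊛ f) a n (suc m) ≡ f a n m
Y⊛-suc f a n m =
  trans (Σ≤-head a λ _ → Σ≤-zero n λ _ → Σ≤-zero (suc m) λ _ → refl)
  (trans (Σ≤-head n λ _ → Σ≤-zero (suc m) λ _ → refl)
  (trans (Σ≤-second m refl λ _ → refl) (ℤ.*-identityˡ _)))

X⊛-zero : ∀ f a m → (X ⊛ f) a 0 m ≡ 0ℤ
X⊛-zero f a m = trans (Σ≤-head a λ _ → Σ≤-zero m λ _ → refl) (Σ≤-zero m λ _ → refl)

X⊛-suc : ∀ f a n m → (X ⊛ f) a (suc n) m ≡ f a n m
X⊛-suc f a n m =
  trans (Σ≤-head a λ _ → Σ≤-zero (suc n) λ _ → Σ≤-zero m λ _ → refl)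
  (trans (Σ≤-second n (Σ≤-zero m λ _ → refl) λ _ → Σ≤-zero m λ _ → refl)
  (trans (Σ≤-head m λ _ → refl) (ℤ.*-identityˡ _)))

T⊛-zero : ∀ f n m → (T ⊛ f) 0 n m ≡ 0ℤ
T⊛-zero f n m = Σ≤-zero n λ _ → Σ≤-zero m λ _ → refl

T⊛-suc : ∀ f a n m → (T ⊛ f) (suc a) n m ≡ f a n m
T⊛-suc f a n m =
  trans (Σ≤-second a (Σ≤-zero n λ _ → Σ≤-zero m λ _ → refl)
                     (λ _ → Σ≤-zero n λ _ → Σ≤-zero m λ _ → refl))
  (trans (Σ≤-head n λ _ → Σ≤-zero m λ _ → refl)
  (trans (Σ≤-head m λ _ → refl) (ℤ.*-identityˡ _)))

embed : ℕ² → PS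
embed F zero    n m = + F n m
embed F (suc a) n m = 0ℤ

embed-cong : ∀ {F G} → (∀ n m → F n m ≡ G n m) → embed F ≈ embed G
embed-cong F≗G zero    n m = cong +_ (F≗G n m)
embed-cong F≗G (suc a) n m = refl

embed-+ : ∀ F G → embed (λ n m → F n m + G n m) ≈ embed F ⊕ embed G
embed-+ F G zero    n m = refl
embed-+ F G (suc a) n m = refl

Y⊛embed : ∀ F → Y ⊛ embed F ≈ embed (↑y F)
Y⊛embed F zero    n zero    = Y⊛-zero (embed F) 0 n
Y⊛embed F zero    n (suc m) = Y⊛-suc (embed F) 0 n m
Y⊛embed F (suc a) n zero    = Y⊛-zero (embed F) (suc a) n
Y⊛embed F (suc a) n (suc m) = Y⊛-suc (embed F) (suc a) n m

X⊛embed : ∀ F → X ⊛ embed F ≈ embed (↑x F)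
X⊛embed F zero    zero    m = X⊛-zero (embed F) 0 m
X⊛embed F zero    (suc n) m = X⊛-suc (embed F) 0 n m
X⊛embed F (suc a) zero    m = X⊛-zero (embed F) (suc a) m
X⊛embed F (suc a) (suc n) m = X⊛-suc (embed F) (suc a) n m

Desc : ℕ → Step → PS
Desc h l = embed (#descents h l)

StartD : ℕ → PS
StartD zero    = 𝟙
StartD (suc h) = Desc h D

embed-#startD : ∀ h → embed (#startD h) ≈ StartD h
embed-#startD zero    zero    zero    zero    = refl
embed-#startD zero    zero    zero    (suc m) = refl
embed-#startD zero    zero    (suc n) m       = refl
embed-#startD zero    (suc a) n       m       = refl
embed-#startD (suc h) a       n       m       = refl

Desc-U : ∀ h → Desc h U ≈ Y ⊛ Desc (suc h) U ⊕ X ⊛ Desc h H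
Desc-U h = begin
  embed (#descents h U)
    ≈⟨ embed-cong (#descents-U h) ⟩
  embed (λ n m → ↑y (#descents (suc h) U) n m + ↑x (#descents h H) n m)
    ≈⟨ embed-+ _ _ ⟩
  embed (↑y (#descents (suc h) U)) ⊕ embed (↑x (#descents h H))
    ≈⟨ +-cong (Y⊛embed _) (X⊛embed _) ⟨
  Y ⊛ Desc (suc h) U ⊕ X ⊛ Desc h H ∎
  where open import Relation.Binary.Reasoning.Setoid ≈-setoid

Desc-H : ∀ h → Desc h H ≈ Y ⊛ Desc (suc h) U ⊕ X ⊛ Desc h H ⊕ StartD h
Desc-H h = begin
  embed (#descents h H)
    ≈⟨ embed-cong (#descents-H h) ⟩
  embed (λ n m → ↑y (#descents (suc h) U) n m + ↑x (#descents h H) n m + #startD h n m)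
    ≈⟨ embed-+ _ _ ⟩
  embed (λ n m → ↑y (#descents (suc h) U) n m + ↑x (#descents h H) n m) ⊕ embed (#startD h)
    ≈⟨ +-cong (embed-+ _ _) (embed-#startD h) ⟩
  embed (↑y (#descents (suc h) U)) ⊕ embed (↑x (#descents h H)) ⊕ StartD h
    ≈⟨ +-congʳ (+-cong (Y⊛embed _) (X⊛embed _)) ⟨
  Y ⊛ Desc (suc h) U ⊕ X ⊛ Desc h H ⊕ StartD h ∎
  where open import Relation.Binary.Reasoning.Setoid ≈-setoid

Desc-D : ∀ h → Desc h D ≈ X ⊛ Desc h H ⊕ StartD h
Desc-D h = begin
  embed (#descents h D)
    ≈⟨ embed-cong (#descents-D h) ⟩
  embed (λ n m → ↑x (#descents h H) n m + #startD h n m)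
    ≈⟨ embed-+ _ _ ⟩
  embed (↑x (#descents h H)) ⊕ embed (#startD h)
    ≈⟨ +-cong (≈-sym (X⊛embed _)) (embed-#startD h) ⟩
  X ⊛ Desc h H ⊕ StartD h ∎
  where open import Relation.Binary.Reasoning.Setoid ≈-setoid

Descᵗ : Step → PS
Descᵗ l a n m = + #descentsᵗ l a n m

Descᵗ-H : Descᵗ H ≈ Descᵗ U ⊕ 𝟙
Descᵗ-H zero    n m = trans (cong +_ (#descentsᵗ-zero-H n m))
  (cong₂ ℤ._+_ (cong +_ (sym (#descentsᵗ-zero-U n m))) (embed-#startD 0 0 n m))
Descᵗ-H (suc a) n m =
  trans (cong +_ (trans (#descentsᵗ-suc H a n m λ ()) (sym (#descentsᵗ-suc U a n m λ ()))))
        (sym (ℤ.+-identityʳ _))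

Descᵗ-U : Descᵗ U ≈ Y ⊛ Desc 1 U ⊕ T ⊛ (X ⊛ Descᵗ H)
Descᵗ-U zero    n       m = sym (trans
  (cong₂ ℤ._+_ (Y⊛embed (#descents 1 U) 0 n m) (T⊛-zero (X ⊛ Descᵗ H) n m))
  (trans (ℤ.+-identityʳ _) (cong +_ (sym (#descentsᵗ-zero-U n m)))))
Descᵗ-U (suc a) zero    m = sym (trans
  (cong₂ ℤ._+_ (Y⊛embed (#descents 1 U) (suc a) 0 m)
               (trans (T⊛-suc (X ⊛ Descᵗ H) a 0 m) (X⊛-zero (Descᵗ H) a m)))
  (cong +_ (sym (#descentsᵗ-suc U a 0 m λ ()))))
Descᵗ-U (suc a) (suc n) m = sym (trans
  (cong₂ ℤ._+_ (Y⊛embed (#descents 1 U) (suc a) (suc n) m)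
               (trans (T⊛-suc (X ⊛ Descᵗ H) a (suc n) m) (X⊛-suc (Descᵗ H) a n m)))
  (trans (ℤ.+-identityˡ _) (cong +_ (sym (#descentsᵗ-suc U a (suc n) m λ ())))))

I≈Y⊛Descᵗ : I ≈ Y ⊛ Descᵗ U
I≈Y⊛Descᵗ a n zero    = trans (cong +_ (#bargraphs-zero a n)) (sym (Y⊛-zero (Descᵗ U) a n))
I≈Y⊛Descᵗ a n (suc m) = trans (cong +_ (#bargraphs-suc a n m)) (sym (Y⊛-suc (Descᵗ U) a n m))

infix 4 _≈[_]_
record _≈[_]_ (f : PS) (k : ℕ) (g : PS) : Set where
  constructor agree
  field agree-below : ∀ a n m → a + n + m < k → f a n m ≡ g a n m
open _≈[_]_

≈[]-setoid : ℕ → Setoid _ _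
≈[]-setoid k = record
  { Carrier       = PS
  ; _≈_           = _≈[ k ]_
  ; isEquivalence = record
    { refl  = agree λ _ _ _ _ → refl
    ; sym   = λ f≈g → agree λ a n m d<k → sym (agree-below f≈g a n m d<k)
    ; trans = λ f≈g g≈h → agree λ a n m d<k →
                trans (agree-below f≈g a n m d<k) (agree-below g≈h a n m d<k)
    }
  }

≈⇒≈[] : ∀ {f g k} → f ≈ g → f ≈[ k ] g
≈⇒≈[] f≈g = agree λ a n m _ → f≈g a n m

≈[]⇒≈ : ∀ {f g} → (∀ k → f ≈[ k ] g) → f ≈ g
≈[]⇒≈ f≈[]g a n m = agree-below (f≈[]g (suc (a + n + m))) a n m ≤-refl

⊕-cong-≈[] : ∀ {k f f′ g g′} → f ≈[ k ] f′ → g ≈[ k ] g′ → f ⊕ g ≈[ k ] f′ ⊕ g′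
⊕-cong-≈[] f≈f′ g≈g′ = agree λ a n m d<k →
  cong₂ ℤ._+_ (agree-below f≈f′ a n m d<k) (agree-below g≈g′ a n m d<k)

⊛-cong-≈[] : ∀ {k f f′ g g′} → f ≈[ k ] f′ → g ≈[ k ] g′ → f ⊛ g ≈[ k ] f′ ⊛ g′
⊛-cong-≈[] f≈f′ g≈g′ = agree λ a n m d<k →
  Σ≤-cong a λ i i≤a → Σ≤-cong n λ j j≤n → Σ≤-cong m λ l l≤m → cong₂ ℤ._*_
    (agree-below f≈f′ i j l (≤-<-trans (+-mono-≤ (+-mono-≤ i≤a j≤n) l≤m) d<k))
    (agree-below g≈g′ (a ∸ i) (n ∸ j) (m ∸ l)
      (≤-<-trans (+-mono-≤ (+-mono-≤ (m∸n≤m a i) (m∸n≤m n j)) (m∸n≤m m l)) d<k))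

Y⊛-cong-≈[] : ∀ {k f g} → f ≈[ k ] g → Y ⊛ f ≈[ suc k ] Y ⊛ g
Y⊛-cong-≈[] {k} {f} {g} f≈g = agree λ where
  a n zero    _ → trans (Y⊛-zero f a n) (sym (Y⊛-zero g a n))
  a n (suc m) d<k → trans (Y⊛-suc f a n m) (trans
    (agree-below f≈g a n m (s≤s⁻¹ (subst (_< suc k) (+-suc (a + n) m) d<k))) (sym (Y⊛-suc g a n m)))

X⊛-cong-≈[] : ∀ {k f g} → f ≈[ k ] g → X ⊛ f ≈[ suc k ] X ⊛ g
X⊛-cong-≈[] {k} {f} {g} f≈g = agree λ where
  a zero    m _ → trans (X⊛-zero f a m) (sym (X⊛-zero g a m))
  a (suc n) m d<k → trans (X⊛-suc f a n m) (trans
    (agree-below f≈g a n m (s≤s⁻¹ (subst (λ d → d + m < suc k) (+-suc a n) d<k))) (sym (X⊛-suc g a n m)))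

distribʳ-assoc : ∀ a b c e d → a ⊛ (b ⊛ d) ⊕ c ⊛ (e ⊛ d) ≈ (a ⊛ b ⊕ c ⊛ e) ⊛ d
distribʳ-assoc a b c e d =
  ≈-trans (+-cong (≈-sym (*-assoc a b d)) (≈-sym (*-assoc c e d))) (≈-sym (distribʳ d (a ⊛ b) (c ⊛ e)))

Desc-suc-≈[] : ∀ k h l → Desc (suc h) l ≈[ k ] Desc h l ⊛ Desc 0 D
StartD-suc-≈[] : ∀ k h → StartD (suc h) ≈[ k ] StartD h ⊛ Desc 0 D

Desc-suc-≈[] zero    h l = agree λ _ _ _ ()
Desc-suc-≈[] (suc k) h U = begin
  Desc (suc h) U
    ≈⟨ ≈⇒≈[] (Desc-U (suc h)) ⟩
  Y ⊛ Desc (2 + h) U ⊕ X ⊛ Desc (suc h) H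
    ≈⟨ ⊕-cong-≈[] (Y⊛-cong-≈[] (Desc-suc-≈[] k (suc h) U)) (X⊛-cong-≈[] (Desc-suc-≈[] k h H)) ⟩
  Y ⊛ (Desc (suc h) U ⊛ Δ) ⊕ X ⊛ (Desc h H ⊛ Δ)
    ≈⟨ ≈⇒≈[] (distribʳ-assoc Y (Desc (suc h) U) X (Desc h H) Δ) ⟩
  (Y ⊛ Desc (suc h) U ⊕ X ⊛ Desc h H) ⊛ Δ
    ≈⟨ ≈⇒≈[] (*-congʳ {Δ} (Desc-U h)) ⟨
  Desc h U ⊛ Δ ∎
  where
  Δ = Desc 0 D
  open import Relation.Binary.Reasoning.Setoid (≈[]-setoid (suc k))
Desc-suc-≈[] (suc k) h H = begin
  Desc (suc h) H
    ≈⟨ ≈⇒≈[] (Desc-H (suc h)) ⟩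
  Y ⊛ Desc (2 + h) U ⊕ X ⊛ Desc (suc h) H ⊕ StartD (suc h)
    ≈⟨ ⊕-cong-≈[] (⊕-cong-≈[] (Y⊛-cong-≈[] (Desc-suc-≈[] k (suc h) U))
                              (X⊛-cong-≈[] (Desc-suc-≈[] k h H)))
                  (StartD-suc-≈[] (suc k) h) ⟩
  Y ⊛ (Desc (suc h) U ⊛ Δ) ⊕ X ⊛ (Desc h H ⊛ Δ) ⊕ StartD h ⊛ Δ
    ≈⟨ ≈⇒≈[] (≈-trans (+-congʳ (distribʳ-assoc Y (Desc (suc h) U) X (Desc h H) Δ))
                                (≈-sym (distribʳ Δ (Y ⊛ Desc (suc h) U ⊕ X ⊛ Desc h H) (StartD h)))) ⟩
  (Y ⊛ Desc (suc h) U ⊕ X ⊛ Desc h H ⊕ StartD h) ⊛ Δ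
    ≈⟨ ≈⇒≈[] (*-congʳ {Δ} (Desc-H h)) ⟨
  Desc h H ⊛ Δ ∎
  where
  Δ = Desc 0 D
  open import Relation.Binary.Reasoning.Setoid (≈[]-setoid (suc k))
Desc-suc-≈[] (suc k) h D = begin
  Desc (suc h) D
    ≈⟨ ≈⇒≈[] (Desc-D (suc h)) ⟩
  X ⊛ Desc (suc h) H ⊕ StartD (suc h)
    ≈⟨ ⊕-cong-≈[] (X⊛-cong-≈[] (Desc-suc-≈[] k h H)) (StartD-suc-≈[] (suc k) h) ⟩
  X ⊛ (Desc h H ⊛ Δ) ⊕ StartD h ⊛ Δ
    ≈⟨ ≈⇒≈[] (≈-trans (+-congʳ (≈-sym (*-assoc X (Desc h H) Δ)))
                      (≈-sym (distribʳ Δ (X ⊛ Desc h H) (StartD h)))) ⟩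
  (X ⊛ Desc h H ⊕ StartD h) ⊛ Δ
    ≈⟨ ≈⇒≈[] (*-congʳ {Δ} (Desc-D h)) ⟨
  Desc h D ⊛ Δ ∎
  where
  Δ = Desc 0 D
  open import Relation.Binary.Reasoning.Setoid (≈[]-setoid (suc k))

StartD-suc-≈[] k zero    = ≈⇒≈[] (≈-sym (*-identityˡ (Desc 0 D)))
StartD-suc-≈[] k (suc h) = Desc-suc-≈[] k h D

Desc-suc : ∀ h l → Desc (suc h) l ≈ Desc h l ⊛ Desc 0 D
Desc-suc h l = ≈[]⇒≈ λ k → Desc-suc-≈[] k h l

P : PS
P = Desc 0 H

Desc₀U≈P-𝟙 : Desc 0 U ≈ P ⊖ 𝟙
Desc₀U≈P-𝟙 = ≈-trans (Desc-U 0) (≈-modulo PS-commutativeRing (const -1ℤ) (Desc-H 0)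
  (solve 4 (λ y q x p → y :* q :+ x :* p := (p :- con 1ℤ) :+ con -1ℤ :* (p :- (y :* q :+ x :* p :+ con 1ℤ)))
           (λ _ _ _ → refl) Y (Desc 1 U) X P))

Desc₁U : Desc 1 U ≈ (P ⊖ 𝟙) ⊛ (X ⊛ P ⊕ 𝟙)
Desc₁U = ≈-trans (Desc-suc 0 U) (*-cong Desc₀U≈P-𝟙 (Desc-D 0))

P-equation : P ≈ Y ⊛ ((P ⊖ 𝟙) ⊛ (X ⊛ P ⊕ 𝟙)) ⊕ X ⊛ P ⊕ 𝟙
P-equation = ≈-trans (Desc-H 0) (+-congʳ {𝟙} (+-congʳ {X ⊛ P} (*-congˡ {Y} Desc₁U)))

Y⊛Desc₁U : Y ⊛ Desc 1 U ≈ P ⊖ X ⊛ P ⊖ 𝟙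
Y⊛Desc₁U = ≈-modulo PS-commutativeRing (const -1ℤ) (Desc-H 0)
  (solve 4 (λ y q x p → y :* q := p :- x :* p :- con 1ℤ :+ con -1ℤ :* (p :- (y :* q :+ x :* p :+ con 1ℤ)))
           (λ _ _ _ → refl) Y (Desc 1 U) X P)

Descᵗ-equation : (𝟙 ⊖ T ⊛ X) ⊛ Descᵗ U ≈ Y ⊛ Desc 1 U ⊕ T ⊛ X
Descᵗ-equation = ≈-modulo PS-commutativeRing 𝟙
  (≈-trans Descᵗ-U (+-congˡ {Y ⊛ Desc 1 U} (*-congˡ {T} (*-congˡ {X} Descᵗ-H))))
  (solve 4 (λ t x j q → (con 1ℤ :- t :* x) :* j
                        := q :+ t :* x :+ con 1ℤ :* (j :- (q :+ t :* (x :* (j :+ con 1ℤ)))))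
           (λ _ _ _ → refl) T X (Descᵗ U) (Y ⊛ Desc 1 U))

S : PS
S = (𝟙 ⊖ X) ⊛ (𝟙 ⊖ Y) ⊖ 𝟚 ⊛ X ⊛ Y ⊛ P

S⊛S≈Rad : S ⊛ S ≈ Rad
S⊛S≈Rad = ≈-modulo PS-commutativeRing (const (ℤ.- + 4) ⊛ X ⊛ Y) P-equation
  (solve 3 (λ x y p →
     let s = (con 1ℤ :- x) :* (con 1ℤ :- y) :- con (+ 2) :* x :* y :* p in
     s :* s := (con 1ℤ :- y) :* ((con 1ℤ :- x) :* (con 1ℤ :- x) :- y :* ((con 1ℤ :+ x) :* (con 1ℤ :+ x)))
               :+ con (ℤ.- + 4) :* x :* y
                  :* (p :- (y :* ((p :- con 1ℤ) :* (x :* p :+ con 1ℤ)) :+ x :* p :+ con 1ℤ)))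
   (λ _ _ _ → refl) X Y P)

Den⊛I : Den ⊛ I ≈ Pnum ⊖ (𝟙 ⊖ X) ⊛ S
Den⊛I = begin
  Den ⊛ I
    ≈⟨ *-congˡ {Den} I≈Y⊛Descᵗ ⟩
  Den ⊛ (Y ⊛ Descᵗ U)
    ≈⟨ solve 4 (λ t x y j → con (+ 2) :* x :* (con 1ℤ :- t :* x) :* (y :* j)
                         := con (+ 2) :* x :* y :* ((con 1ℤ :- t :* x) :* j)) (λ _ _ _ → refl) T X Y (Descᵗ U) ⟩
  𝟚 ⊛ X ⊛ Y ⊛ ((𝟙 ⊖ T ⊛ X) ⊛ Descᵗ U)
    ≈⟨ *-congˡ {𝟚 ⊛ X ⊛ Y} (≈-trans Descᵗ-equation (+-congʳ {T ⊛ X} Y⊛Desc₁U)) ⟩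
  𝟚 ⊛ X ⊛ Y ⊛ (P ⊖ X ⊛ P ⊖ 𝟙 ⊕ T ⊛ X)
    ≈⟨ solve 4 (λ t x y p →
         let s = (con 1ℤ :- x) :* (con 1ℤ :- y) :- con (+ 2) :* x :* y :* p in
         con (+ 2) :* x :* y :* (p :- x :* p :- con 1ℤ :+ t :* x)
         := con 1ℤ :- con (+ 2) :* x :- y :+ x :* x :+ (con (+ 2) :* t :- con 1ℤ) :* x :* x :* y
            :- (con 1ℤ :- x) :* s)
       (λ _ _ _ → refl) T X Y P ⟩
  Pnum ⊖ (𝟙 ⊖ X) ⊛ S ∎
  where open import Relation.Binary.Reasoning.Setoid ≈-setoid

mainTheorem13 : Σ PS (λ S → (S 0 0 0 ≡ 1ℤ) × (S ⊛ S ≈ Rad) × (Den ⊛ I ≈ Pnum ⊖ (𝟙 ⊖ X) ⊛ S))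
mainTheorem13 = S , refl , S⊛S≈Rad , Den⊛I
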